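{- Let $H$ be a finite connected graph. The map $B\mapsto \mathrm{cone}_H(B)_{\ge0}$ is a bijection from the set of pre-bracketings of $H$ onto the set of cones of the positive bracket associahedral fan $\mathcal{B}_{\ge0}(H)$, and it is order preserving (with order-preserving inverse) when pre-bracketings carry the pre-bracketing order and cones are ordered by inclusion.
   Context: A bracket of a connected graph $G$ is a connected subgraph with at least one edge, identified with its edge set. A bracketing of $G$ is a set $B$ of brackets, any two either nested or sharing no edges and no vertices, with $G\in B$ (if $G$ has no edges, its only bracketing is $\emptyset$). For $e$ an edge, $\mathrm{br}_B(e)$ is the smallest bracket of $B$ containing $e$, and $e\ge_B f$ means $\mathrm{br}_B(e)\supseteq\mathrm{br}_B(f)$. For a bracketing $B$ of $H$, $\mathrm{cone}_H(B)=\{y\in\mathbb R^{E(H)}: y_e\ge y_f \text{ whenever } e\ge_B f\}$. The positive bracket associahedral fan $\mathcal B_{\ge0}(H)$ is the collection of cones $\mathrm{cone}_H(B)\cap\{y\ge 0: y_f=0 \text{ for } f\in F\}$ over all bracketings $B$ of $H$ and subsets $F\subseteq E(H)$ (the intersection of the bracket associahedral fan $\{\mathrm{cone}_H(B)\}$ with the nonnegative orthant, with the inherited polyhedral structure). A pre-bracketing of $H$ is a pair $(G,B)$ where $G$ is obtained from $H$ by contracting a set $K$ of edges (so $E(G)=E(H)\setminus K$) and $B$ is a bracketing of $G$; it is written $B$ since $G$ is the maximal bracket. Its positive cone is $\mathrm{cone}_H(B)_{\ge0}=\{y\in\mathbb R^{E(H)}: y_e=0 \text{ for } e\in K,\ y_e\ge0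 \text{ for } e\notin K,\ y_e\ge y_f \text{ whenever } e\ge_B f\}$. The order on pre-bracketings is the reflexive–transitive closure of $B\lessdot B'$ where $B$ is obtained from $B'$ either by removing a bracket other than the maximal one, or by contracting an inclusion-minimal bracket $\mu$ of $B'$: $B=\{\beta/\mu: \beta\in B',\beta\neq\mu\}$ on the graph $G'/\mu$.
   Formalization: The cones $\mathrm{cone}_H(B)_{\ge0}$ and the cones of $\mathcal B_{\ge0}(H)$ are sets of vectors with rational entries indexed by the edges of H, rather than subsets of $\mathbb R^{E(H)}$. -}

module Defs where

open import Level using (0ℓ)
open import Data.Bool using (Bool; true; false)
open import Data.Nat using (ℕ)
open import Data.Fin using (Fin)
open import Data.Fin.Subset using (Subset; _∈_; _∉_; _⊆_; _⊇_; ∁; _∪_; _─_; Nonempty)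
open import Data.Product using (Σ; ∃; ∃-syntax; _×_; _,_)
open import Data.Sum using (_⊎_)
open import Data.Rational using (ℚ; 0ℚ; _≤_)
open import Relation.Nullary using (¬_)
open import Relation.Binary.PropositionalEquality using (_≡_; _≢_)
open import Relation.Binary.Construct.Closure.ReflexiveTransitive using (Star)
open import Relation.Unary using (Pred; _≐_)
open import Function using (_⇔_)

-- Finite (multi)graphs: vertices Fin n, edges Fin m, each edge has two
-- endpoints (loops and parallel edges allowed).

record Graph (n m : ℕ) : Set where
  field
    src tgt : Fin m → Fin n

module _ {n m : ℕ} (H : Graph n m) where
  open Graph H

  Endpoint : Fin m → Fin n → Set
  Endpoint e x = (x ≡ src e) ⊎ (x ≡ tgt e)

  Adj : Subset m → Fin n → Fin n → Set
  Adj A u v = ∃[ e ] (e ∈ A × Endpoint e u × Endpoint e v)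

  Reach : Subset m → Fin n → Fin n → Set
  Reach A = Star (Adj A)

  Connected : Set
  Connected = ∀ u v → Reach Data.Fin.Subset.⊤ u v

  -- The contraction G = H / K (K a set of edges): E(G) = E(H) ∖ K, and the
  -- vertices of G are the classes of V(H) under "joined by a K-walk".
  -- We never build the quotient: an edge set S ⊆ E(G) is described via H.

  -- S ⊆ E(H/K) spans a connected subgraph of H/K with at least one edge.
  -- (Two vertices of H/K are joined by an S-walk in H/K iff their
  --  representatives are joined by an (S ∪ K)-walk in H.)
  IsBracket : Subset m → Subset m → Set
  IsBracket K S =
    (∀ e → e ∈ S → e ∉ K) ×
    Nonempty S ×
    (∀ e f x y → e ∈ S → f ∈ S → Endpoint e x → Endpoint f y →
       Reach (S ∪ K) x y)

  -- S and T (edge sets of H/K) share a vertex of H/K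
  ShareVertex : Subset m → Subset m → Subset m → Set
  ShareVertex K S T =
    ∃[ e ] ∃[ f ] ∃[ x ] ∃[ y ]
      (e ∈ S × f ∈ T × Endpoint e x × Endpoint f y × Reach K x y)

  ShareEdge : Subset m → Subset m → Set
  ShareEdge S T = ∃[ e ] (e ∈ S × e ∈ T)

  _∈B_ : Subset m → (Subset m → Bool) → Set
  S ∈B B = B S ≡ true

  IsBracketing : Subset m → (Subset m → Bool) → Set
  IsBracketing K B =
    (∀ S → S ∈B B → IsBracket K S) ×
    (∀ S T → S ∈B B → T ∈B B →
       (S ⊆ T ⊎ T ⊆ S) ⊎ (¬ ShareEdge S T × ¬ ShareVertex K S T)) ×
    -- G = H/K belongs to B whenever G has an edge
    ((∃[ e ] e ∉ K) → ∁ K ∈B B)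

  record PreBracketing : Set where
    constructor preBr
    field
      K   : Subset m
      B   : Subset m → Bool
      ok  : IsBracketing K B

  Bracketing : Set
  Bracketing = Σ (Subset m → Bool) (IsBracketing Data.Fin.Subset.⊥)

  IsBr : (Subset m → Bool) → Fin m → Subset m → Set
  IsBr B e β = β ∈B B × e ∈ β × (∀ β' → β' ∈B B → e ∈ β' → β ⊆ β')

  GeB : (Subset m → Bool) → Fin m → Fin m → Set
  GeB B e f = ∃[ βe ] ∃[ βf ] (IsBr B e βe × IsBr B f βf × βe ⊇ βf)

  -- vectors in Q^{E(H)} (rational stand-in for R^{E(H)})
  Vect : Set
  Vect = Fin m → ℚ

  cone : (Subset m → Bool) → Pred Vect 0ℓ
  cone B y = ∀ e f → GeB B e f → y f ≤ y e

  posCone : PreBracketing → Pred Vect 0ℓ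
  posCone P y =
    (∀ e → e ∈ PreBracketing.K P → y e ≡ 0ℚ) ×
    (∀ e → e ∉ PreBracketing.K P → 0ℚ ≤ y e) ×
    cone (PreBracketing.B P) y

  fanCone : Bracketing → Subset m → Pred Vect 0ℓ
  fanCone (B , _) F y =
    cone B y × (∀ e → 0ℚ ≤ y e) × (∀ f → f ∈ F → y f ≡ 0ℚ)

  IsFanCone : Pred Vect 0ℓ → Set
  IsFanCone C = ∃[ B ] ∃[ F ] (C ≐ fanCone B F)

  _≈P_ : PreBracketing → PreBracketing → Set
  P ≈P Q = (PreBracketing.K P ≡ PreBracketing.K Q) ×
           (∀ S → PreBracketing.B P S ≡ PreBracketing.B Q S)

  _⋖_ : PreBracketing → PreBracketing → Set
  P ⋖ Q = Remove ⊎ Contract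
    where
      KP = PreBracketing.K P
      KQ = PreBracketing.K Q
      BP = PreBracketing.B P
      BQ = PreBracketing.B Q
      Remove : Set
      Remove = KP ≡ KQ × ∃[ β ] (β ∈B BQ × β ≢ ∁ KQ ×
                 (∀ S → (S ∈B BP) ⇔ (S ∈B BQ × S ≢ β)))
      Contract : Set
      Contract = ∃[ μ ] (μ ∈B BQ × (∀ β → β ∈B BQ → β ⊆ μ → β ≡ μ) ×
                   KP ≡ KQ ∪ μ ×
                   (∀ S → (S ∈B BP) ⇔ (∃[ β ] (β ∈B BQ × β ≢ μ × S ≡ β ─ μ))))

  _≤P_ : PreBracketing → PreBracketing → Set
  _≤P_ = Star (λ P Q → P ≈P Q ⊎ P ⋖ Q)

{-# OPTIONS --safe #-}
module Submission where

-- It is a cone of the fan: it equals cone(B̂) ∩ {y ≥ 0, y = 0 on K} for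
-- the bracketing B̂ of H formed by H, the components of K and the preimages of the brackets
-- of B.  Conversely, on cone(B) ∩ {y ≥ 0, y = 0 on F} every y vanishes on the edges below F,
-- and contracting those edges, one minimal bracket at a time, gives a pre-bracketing with
-- exactly this positive cone.
--
-- Inclusions of positive cones are detected by 0/1 vectors: the indicator of the edges
-- outside K P and outside a ≥_P-down-closed set lies in posCone P.  Testing these in posCone Q
-- shows K Q ⊆ K P, that no edge of K P dominates in Q an edge outside K P, and that ≥_Q
-- refines ≥_P outside K P.  So if K P = K Q the brackets of P are brackets of Q, and P is
-- reached from Q by removing brackets; otherwise some bracket of Q lies inside K P and a
-- minimal one can be contracted.  Induction on K Q gives the order statement, and
-- antisymmetry gives injectivity.

open import Defs

module PreBracketingCones where

  open import Level using (Level; 0ℓ)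
  open import Data.Bool using (Bool; true; if_then_else_)
  open import Data.Bool.Properties using (⇔→≡) renaming (_≟_ to _≟ᵇ_)
  open import Data.Empty using (⊥-elim)
  open import Data.Fin using (Fin; _≟_)
  open import Data.Fin.Properties using (any?)
  open import Data.Fin.Subset
  open import Data.Fin.Subset.Properties
  open import Data.Fin.Subset.Induction using (⊂-wellFounded; ⊃-wellFounded; Acc; acc)
  open import Data.List using (List; []; _∷_; [_]; map; _++_)
  open import Data.List.Membership.Propositional using () renaming (_∈_ to _∈ₗ_)
  open import Data.List.Membership.Propositional.Properties using (∈-map⁺; ∈-++⁺ˡ; ∈-++⁺ʳ)
  open import Data.List.Relation.Unary.Any as Any using (here; there)
  open import Data.Nat using (ℕ; zero; suc)
  open import Data.Product using (∃; ∃-syntax; _×_; _,_; proj₁; proj₂)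
  open import Data.Rational using (ℚ; 0ℚ; 1ℚ; _≤_; _≤?_)
  open import Data.Rational.Properties using (≤-refl; ≤-antisym)
  open import Data.Sum as Sum using (_⊎_; inj₁; inj₂; [_,_]′)
  open import Data.Vec using (tabulate; []; _∷_; here; there)
  open import Data.Vec.Properties using (≡-dec; lookup∘tabulate; []=⇒lookup; lookup⇒[]=)
  open import Function using (_∘_; id; _⇔_; mk⇔; Equivalence)
  open import Relation.Binary using (Rel; DecidableEquality) renaming (Decidable to Decidable₂)
  open import Relation.Binary.Construct.Closure.ReflexiveTransitive as Star using (Star; ε; _◅_; _◅◅_)
  open import Relation.Binary.PropositionalEquality using (_≡_; _≢_; refl; sym; trans; cong; subst; subst₂)
  open import Relation.Nullary using (¬_; Dec; yes; no; does; contradiction)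
  open import Relation.Nullary.Decidable using (dec-true; from-yes; from-no; _×-dec_; _⊎-dec_; ¬?)
  open import Relation.Unary as U using (Pred; Decidable)
  open import Relation.Unary.Properties using (≐-trans)

  open Equivalence using (to; from)

  private
    variable
      ℓ : Level
      n m : ℕ
      p q : Subset n

  does-true⇒ : ∀ {A : Set ℓ} (a? : Dec A) → does a? ≡ true → A
  does-true⇒ (yes a) _ = a

  infix 4 _≟ˢ_
  _≟ˢ_ : DecidableEquality (Subset n)
  _≟ˢ_ = ≡-dec _≟ᵇ_

  toSubset : {P : Pred (Fin n) ℓ} → Decidable P → Subset n
  toSubset P? = tabulate (does ∘ P?)

  module _ {P : Pred (Fin n) ℓ} (P? : Decidable P) where

    ∈-toSubset⁺ : ∀ {x} → P x → x ∈ toSubset P?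
    ∈-toSubset⁺ {x} px = lookup⇒[]= x _ (trans (lookup∘tabulate _ x) (dec-true (P? x) px))

    ∈-toSubset⁻ : ∀ {x} → x ∈ toSubset P? → P x
    ∈-toSubset⁻ {x} x∈ = does-true⇒ (P? x) (trans (sym (lookup∘tabulate _ x)) ([]=⇒lookup x∈))

  x∈p─q⇒x∉q : ∀ {x : Fin n} → x ∈ p ─ q → x ∉ q
  x∈p─q⇒x∉q {p = _ ∷ _} {q = inside  ∷ _} () here
  x∈p─q⇒x∉q {p = _ ∷ _} {q = _ ∷ _} (there x∈) (there x∈q) = x∈p─q⇒x∉q x∈ x∈q

  ∁[p∪q]≡∁p─q : ∀ (p q : Subset n) → ∁ (p ∪ q) ≡ ∁ p ─ q
  ∁[p∪q]≡∁p─q [] [] = refl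
  ∁[p∪q]≡∁p─q (outside ∷ p) (outside ∷ q) = cong (inside ∷_) (∁[p∪q]≡∁p─q p q)
  ∁[p∪q]≡∁p─q (outside ∷ p) (inside ∷ q) = cong (outside ∷_) (∁[p∪q]≡∁p─q p q)
  ∁[p∪q]≡∁p─q (inside ∷ p) (outside ∷ q) = cong (outside ∷_) (∁[p∪q]≡∁p─q p q)
  ∁[p∪q]≡∁p─q (inside ∷ p) (inside ∷ q) = cong (outside ∷_) (∁[p∪q]≡∁p─q p q)

  p⊆q⇒p─r⊆q─r : ∀ {r : Subset n} → p ⊆ q → p ─ r ⊆ q ─ r
  p⊆q⇒p─r⊆q─r {p = p} {r = r} p⊆q x∈p─r =
    x∈p∧x∉q⇒x∈p─q (p⊆q (p─q⊆p p r x∈p─r)) (x∈p─q⇒x∉q x∈p─r)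

  p∪q⊆[p─r]∪[q∪r] : ∀ {r : Subset n} → p ∪ q ⊆ (p ─ r) ∪ (q ∪ r)
  p∪q⊆[p─r]∪[q∪r] {p = p} {q} {r} {x} x∈p∪q with x ∈? r | x∈p∪q⁻ p q x∈p∪q
  ... | yes x∈r | _ = x∈p∪q⁺ (inj₂ (q⊆p∪q q r x∈r))
  ... | no x∉r | inj₁ x∈p = x∈p∪q⁺ (inj₁ (x∈p∧x∉q⇒x∈p─q x∈p x∉r))
  ... | no x∉r | inj₂ x∈q = x∈p∪q⁺ (inj₂ (p⊆p∪q r x∈q))

  ⊆-or-∉ : (p q : Subset n) → p ⊆ q ⊎ ∃[ x ] (x ∈ p × x ∉ q)
  ⊆-or-∉ p q with any? (λ x → x ∈? p ×-dec ¬? (x ∈? q))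
  ... | yes outlier = inj₂ outlier
  ... | no ¬outlier = inj₁ p⊆q
    where
    p⊆q : p ⊆ q
    p⊆q {x} x∈p with x ∈? q
    ... | yes x∈q = x∈q
    ... | no x∉q = contradiction (x , x∈p , x∉q) ¬outlier

  module _ {P : Pred (Subset n) ℓ} (P? : Decidable P) where

    ⊆-minimal : P p → ∃[ b ] (P b × b ⊆ p × (∀ {c} → P c → c ⊆ b → b ⊆ c))
    ⊆-minimal {p} = go p (⊂-wellFounded p)
      where
      go : ∀ p → Acc _⊂_ p → P p → ∃[ b ] (P b × b ⊆ p × (∀ {c} → P c → c ⊆ b → b ⊆ c))
      go p (acc rec) Pp with anySubset? (λ c → P? c ×-dec c ⊂? p)
      ... | yes (c , Pc , c⊂p) =
        let b , Pb , b⊆c , min = go c (rec c⊂p) Pc in b , Pb , ⊆-trans b⊆c (proj₁ c⊂p) , min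
      ... | no ¬smaller = p , Pp , id , p⊆
        where
        p⊆ : ∀ {c} → P c → c ⊆ p → p ⊆ c
        p⊆ {c} Pc c⊆p with ⊆-or-∉ p c
        ... | inj₁ p⊆c = p⊆c
        ... | inj₂ (x , x∈p , x∉c) = contradiction (c , Pc , (λ {_} → c⊆p) , x , x∈p , x∉c) ¬smaller

    ⊆-maximal : P p → ∃[ b ] (P b × p ⊆ b × (∀ {c} → P c → b ⊆ c → c ⊆ b))
    ⊆-maximal {p} = go p (⊃-wellFounded p)
      where
      go : ∀ p → Acc _⊃_ p → P p → ∃[ b ] (P b × p ⊆ b × (∀ {c} → P c → b ⊆ c → c ⊆ b))
      go p (acc rec) Pp with anySubset? (λ c → P? c ×-dec p ⊂? c)
      ... | yes (c , Pc , p⊂c) =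
        let b , Pb , c⊆b , max = go c (rec p⊂c) Pc in b , Pb , ⊆-trans (proj₁ p⊂c) c⊆b , max
      ... | no ¬larger = p , Pp , id , ⊆p
        where
        ⊆p : ∀ {c} → P c → p ⊆ c → c ⊆ p
        ⊆p {c} Pc p⊆c with ⊆-or-∉ c p
        ... | inj₁ c⊆p = c⊆p
        ... | inj₂ (x , x∈c , x∉p) = contradiction (c , Pc , (λ {_} → p⊆c) , x , x∈c , x∉p) ¬larger

  allSubsets : ∀ m → List (Subset m)
  allSubsets zero = [ [] ]
  allSubsets (suc m) = map (inside ∷_) (allSubsets m) ++ map (outside ∷_) (allSubsets m)

  ∈-allSubsets : ∀ (S : Subset m) → S ∈ₗ allSubsets m
  ∈-allSubsets [] = here refl
  ∈-allSubsets (inside ∷ S) = ∈-++⁺ˡ (∈-map⁺ (inside ∷_) (∈-allSubsets S))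
  ∈-allSubsets {suc m} (outside ∷ S) =
    ∈-++⁺ʳ (map (inside ∷_) (allSubsets m)) (∈-map⁺ (outside ∷_) (∈-allSubsets S))

  module _ {R : Rel (Fin n) ℓ} (R? : Decidable₂ R) (x : Fin n) where

    private
      Reached : Subset n → Set ℓ
      Reached V = ∀ {v} → v ∈ V → Star R x v

      Closed : Subset n → Set ℓ
      Closed V = ∀ {u v} → u ∈ V → R u v → v ∈ V

      Closed-Star : ∀ {V u v} → Closed V → u ∈ V → Star R u v → v ∈ V
      Closed-Star closed u∈V ε = u∈V
      Closed-Star closed u∈V (uRw ◅ w⋆v) = Closed-Star closed (closed u∈V uRw) w⋆v

      closure : ∀ V → Acc _⊃_ V → Reached V → ∃[ W ] (V ⊆ W × Reached W × Closed W)
      closure V (acc rec) reached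
        with any? (λ u → any? (λ v → u ∈? V ×-dec ¬? (v ∈? V) ×-dec R? u v))
      ... | yes (u , v , u∈V , v∉V , uRv) =
        let W , V′⊆W , reachedW , closedW = closure V′ (rec V⊂V′) reached′
        in W , V′⊆W ∘ p⊆p∪q _ , reachedW , closedW
        where
        V′ = V ∪ ⁅ v ⁆
        V⊂V′ : V ⊂ V′
        V⊂V′ = (λ {_} → p⊆p∪q _) , v , q⊆p∪q V _ (x∈⁅x⁆ v) , v∉V
        reached′ : Reached V′
        reached′ w∈V′ with x∈p∪q⁻ V _ w∈V′
        ... | inj₁ w∈V = reached w∈V
        ... | inj₂ w∈⁅v⁆ rewrite x∈⁅y⁆⇒x≡y v w∈⁅v⁆ = reached u∈V ◅◅ (uRv ◅ ε)
      ... | no ¬exit = V , id , reached , closed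
        where
        closed : Closed V
        closed {u} {v} u∈V uRv with v ∈? V
        ... | yes v∈V = v∈V
        ... | no v∉V = contradiction (u , v , u∈V , v∉V , uRv) ¬exit

    Star? : U.Decidable (Star R x)
    Star? y with closure ⁅ x ⁆ (⊃-wellFounded _) (λ v∈ → subst (Star R x) (sym (x∈⁅y⁆⇒x≡y x v∈)) ε)
    ... | W , ⁅x⁆⊆W , reached , closed with y ∈? W
    ...   | yes y∈W = yes (reached y∈W)
    ...   | no y∉W = no (λ x⋆y → y∉W (Closed-Star closed (⁅x⁆⊆W (x∈⁅x⁆ x)) x⋆y))

  -- Walks in H and in its contractions

  module _ {n m : ℕ} (H : Graph n m) where
    open Graph H

    private
      variable
        A A′ M S T β β′ : Subset m
        e f g : Fin m
        u v x y : Fin n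

    src-Endpoint : ∀ e → Endpoint H e (src e)
    src-Endpoint e = inj₁ refl

    Endpoint? : ∀ e x → Dec (Endpoint H e x)
    Endpoint? e x = (x ≟ src e) ⊎-dec (x ≟ tgt e)

    Adj? : ∀ A → Decidable₂ (Adj H A)
    Adj? A u v = any? (λ e → e ∈? A ×-dec Endpoint? e u ×-dec Endpoint? e v)

    Reach? : ∀ A → Decidable₂ (Reach H A)
    Reach? A = Star? (Adj? A)

    edge-Reach : e ∈ A → Endpoint H e x → Endpoint H e y → Reach H A x y
    edge-Reach e∈A ex ey = (_ , e∈A , ex , ey) ◅ ε

    Reach-mono : A ⊆ A′ → Reach H A x y → Reach H A′ x y
    Reach-mono A⊆A′ = Star.map (λ (e , e∈A , eu , ev) → e , A⊆A′ e∈A , eu , ev)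

    Reach-sym : Reach H A x y → Reach H A y x
    Reach-sym = Star.reverse (λ (e , e∈A , eu , ev) → e , e∈A , ev , eu)

    -- In H / A, the image of u is an endpoint of an edge of S.
    Incident : Subset m → Subset m → Fin n → Set
    Incident A S u = ∃[ s ] ∃[ x ] (s ∈ S × Endpoint H s x × Reach H A x u)

    Incident? : ∀ A S u → Dec (Incident A S u)
    Incident? A S u = any? (λ s → any? (λ x → s ∈? S ×-dec Endpoint? s x ×-dec Reach? A x u))

    Incident-Reach : Incident A S u → Reach H (S ∪ A) u v → Incident A S v
    Incident-Reach u∼S ε = u∼S
    Incident-Reach {A} {S} (s , x , s∈S , sx , x⋆u) ((e , e∈S∪A , eu , ew) ◅ w⋆v)
      with x∈p∪q⁻ S A e∈S∪A
    ... | inj₁ e∈S = Incident-Reach (e , _ , e∈S , ew , ε) w⋆v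
    ... | inj₂ e∈A = Incident-Reach (s , x , s∈S , sx , x⋆u ◅◅ edge-Reach e∈A eu ew) w⋆v

    Reach-∪⁻ : Reach H (A ∪ M) x y → Reach H A x y ⊎ Incident A M x
    Reach-∪⁻ ε = inj₁ ε
    Reach-∪⁻ {A} {M} ((e , e∈A∪M , ex , ew) ◅ w⋆y) with e ∈? M | x∈p∪q⁻ A M e∈A∪M
    ... | yes e∈M | _ = inj₂ (e , _ , e∈M , ex , ε)
    ... | no e∉M | inj₂ e∈M = contradiction e∈M e∉M
    ... | no _ | inj₁ e∈A with Reach-∪⁻ w⋆y
    ...   | inj₁ w⋆y′ = inj₁ (edge-Reach e∈A ex ew ◅◅ w⋆y′)
    ...   | inj₂ (g , z , g∈M , gz , z⋆w) = inj₂ (g , z , g∈M , gz , z⋆w ◅◅ edge-Reach e∈A ew ex)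

    exit-edge : T ⊆ S → Incident A T u → Reach H (S ∪ A) u y → f ∈ S → f ∉ T → Endpoint H f y →
           ∃[ g ] (g ∈ S × g ∉ T × ∃[ v ] (Incident A T v × Endpoint H g v))
    exit-edge {T = T} {S = S} {A = A} {f = f} T⊆S u∼T u⋆y f∈S f∉T fy with Reach-∪⁻ (Reach-mono split u⋆y)
      where
      split : S ∪ A ⊆ (T ∪ A) ∪ (S ─ T)
      split {e} e∈S∪A with x∈p∪q⁻ S A e∈S∪A | e ∈? T
      ... | inj₂ e∈A | _ = x∈p∪q⁺ (inj₁ (q⊆p∪q T A e∈A))
      ... | inj₁ e∈S | yes e∈T = x∈p∪q⁺ (inj₁ (p⊆p∪q A e∈T))
      ... | inj₁ e∈S | no e∉T = x∈p∪q⁺ (inj₂ (x∈p∧x∉q⇒x∈p─q e∈S e∉T))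
    ... | inj₁ u⋆y′ = f , f∈S , f∉T , _ , Incident-Reach u∼T u⋆y′ , fy
    ... | inj₂ (g , z , g∈S─T , gz , z⋆u) =
      g , p─q⊆p S T g∈S─T , x∈p─q⇒x∉q g∈S─T , z , Incident-Reach u∼T (Reach-sym z⋆u) , gz

    Compatible : Subset m → Subset m → Subset m → Set
    Compatible K S T = (S ⊆ T ⊎ T ⊆ S) ⊎ (¬ ShareEdge H S T × ¬ ShareVertex H K S T)

    DownClosed : (Subset m → Bool) → Subset m → Set
    DownClosed B Z = ∀ {a b} → GeB H B a b → a ∈ Z → b ∈ Z

    module PreBracketingProperties (P : PreBracketing H) where
      open PreBracketing P

      bracket : B S ≡ true → IsBracket H K S
      bracket = proj₁ ok _

      compatible : B S ≡ true → B T ≡ true → Compatible K S T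
      compatible = proj₁ (proj₂ ok) _ _

      top : (∃[ e ] e ∉ K) → B (∁ K) ≡ true
      top = proj₂ (proj₂ ok)

      ∉K : B S ≡ true → e ∈ S → e ∉ K
      ∉K S∈B = proj₁ (bracket S∈B) _

      ShareVertex⇒nested : B S ≡ true → B T ≡ true → ShareVertex H K S T → S ⊆ T ⊎ T ⊆ S
      ShareVertex⇒nested S∈B T∈B shared with compatible S∈B T∈B
      ... | inj₁ nested = nested
      ... | inj₂ (_ , apart) = contradiction shared apart

      ShareEdge⇒nested : B S ≡ true → B T ≡ true → e ∈ S → e ∈ T → S ⊆ T ⊎ T ⊆ S
      ShareEdge⇒nested S∈B T∈B e∈S e∈T with compatible S∈B T∈B
      ... | inj₁ nested = nested
      ... | inj₂ (apart , _) = contradiction (_ , e∈S , e∈T) apart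

      br-exists : e ∉ K → ∃ (IsBr H B e)
      br-exists {e} e∉K
        with ⊆-minimal (λ β → B β ≟ᵇ true ×-dec e ∈? β) (top (e , e∉K) , x∉p⇒x∈∁p e∉K)
      ... | β , (β∈B , e∈β) , _ , minimal = β , β∈B , e∈β , least
        where
        least : ∀ β′ → B β′ ≡ true → e ∈ β′ → β ⊆ β′
        least β′ β′∈B e∈β′ with ShareEdge⇒nested β∈B β′∈B e∈β e∈β′
        ... | inj₁ β⊆β′ = β⊆β′
        ... | inj₂ β′⊆β = minimal (β′∈B , e∈β′) β′⊆β

      br : e ∉ K → Subset m
      br e∉K = proj₁ (br-exists e∉K)

      br-IsBr : (e∉K : e ∉ K) → IsBr H B e (br e∉K)
      br-IsBr e∉K = proj₂ (br-exists e∉K)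

      br∈B : (e∉K : e ∉ K) → B (br e∉K) ≡ true
      br∈B e∉K = proj₁ (br-IsBr e∉K)

      ∈br : (e∉K : e ∉ K) → e ∈ br e∉K
      ∈br e∉K = proj₁ (proj₂ (br-IsBr e∉K))

      br-least : (e∉K : e ∉ K) → B β ≡ true → e ∈ β → br e∉K ⊆ β
      br-least e∉K = proj₂ (proj₂ (br-IsBr e∉K)) _

      IsBr-unique : IsBr H B e β → IsBr H B e β′ → β ≡ β′
      IsBr-unique (β∈B , e∈β , least) (β′∈B , e∈β′ , least′) =
        ⊆-antisym (least _ β′∈B e∈β′) (least′ _ β∈B e∈β)

      ∈br⇒GeB : IsBr H B e β → f ∈ β → GeB H B e f
      ∈br⇒GeB e-br@(β∈B , _ , _) f∈β = _ , _ , e-br , br-IsBr f∉K , br-least f∉K β∈B f∈β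
        where f∉K = ∉K β∈B f∈β

      GeB⇒∈br : GeB H B e f → IsBr H B e β → f ∈ β
      GeB⇒∈br (_ , _ , e-br′ , (_ , f∈βf , _) , βf⊆βe) e-br rewrite IsBr-unique e-br′ e-br = βf⊆βe f∈βf

      GeB⇒∉K : GeB H B e f → e ∉ K
      GeB⇒∉K (_ , _ , (βe∈B , e∈βe , _) , _) = ∉K βe∈B e∈βe

      br-DownClosed : (e∉K : e ∉ K) → DownClosed B (br e∉K)
      br-DownClosed e∉K a≥b a∈βe = br-least a∉K (br∈B e∉K) a∈βe (GeB⇒∈br a≥b (br-IsBr a∉K))
        where a∉K = GeB⇒∉K a≥b

      minimal-⊆ : B β ≡ true →
                  ∃[ μ ] (B μ ≡ true × μ ⊆ β × (∀ γ → B γ ≡ true → γ ⊆ μ → γ ≡ μ))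
      minimal-⊆ β∈B with ⊆-minimal (λ γ → B γ ≟ᵇ true) β∈B
      ... | μ , μ∈B , μ⊆β , minimal =
        μ , μ∈B , μ⊆β , λ γ γ∈B γ⊆μ → ⊆-antisym γ⊆μ (minimal γ∈B γ⊆μ)

      brs⊆⇒∈B : IsBracket H K S → (∀ {g β} → g ∈ S → IsBr H B g β → β ⊆ S) → B S ≡ true
      brs⊆⇒∈B {S} (disjoint , (g₀ , g₀∈S) , connected) brs⊆S
        with ⊆-maximal (λ T → B T ≟ᵇ true ×-dec T ⊆? S)
                       (br∈B _ , brs⊆S g₀∈S (br-IsBr (disjoint g₀ g₀∈S)))
      ... | T , (T∈B , T⊆S) , βg₀⊆T , maximal = subst (λ X → B X ≡ true) (⊆-antisym T⊆S S⊆T) T∈B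
        where
        touching⇒∈T : ∀ {g v} → g ∈ S → Incident K T v → Endpoint H g v → g ∈ T
        touching⇒∈T g∈S (t , x , t∈T , tx , x⋆v) gv
          with ShareVertex⇒nested T∈B (br∈B g∉K) (t , _ , x , _ , t∈T , ∈br g∉K , tx , gv , x⋆v)
          where g∉K = disjoint _ g∈S
        ... | inj₂ βg⊆T = βg⊆T (∈br _)
        ... | inj₁ T⊆βg = maximal (br∈B _ , brs⊆S g∈S (br-IsBr _)) T⊆βg (∈br _)

        S⊆T : S ⊆ T
        S⊆T with ⊆-or-∉ S T
        ... | inj₁ S⊆T = S⊆T
        ... | inj₂ (f , f∈S , f∉T) =
          let g , g∈S , g∉T , v , v∼T , gv =
                exit-edge T⊆S (g₀ , _ , βg₀⊆T (∈br _) , src-Endpoint g₀ , ε)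
                  (connected g₀ f _ _ g₀∈S f∈S (src-Endpoint g₀) (src-Endpoint f)) f∈S f∉T (src-Endpoint f)
          in contradiction (touching⇒∈T g∈S v∼T gv) g∉T

    IsBracketing-does : ∀ K {Br : Pred (Subset m) 0ℓ} (Br? : Decidable Br) →
                    (∀ {S} → Br S → IsBracket H K S) → (∀ {S T} → Br S → Br T → Compatible K S T) →
                    ((∃[ e ] e ∉ K) → Br (∁ K)) → IsBracketing H K (does ∘ Br?)
    IsBracketing-does K Br? bracket compatible top =
      (λ S S∈ → bracket (does-true⇒ (Br? S) S∈)) ,
      (λ S T S∈ T∈ → compatible (does-true⇒ (Br? S) S∈) (does-true⇒ (Br? T) T∈)) ,
      (λ nonempty → dec-true (Br? (∁ K)) (top nonempty))

  -- Test vectors and inclusion of positive cones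

  0≤1 : 0ℚ ≤ 1ℚ
  0≤1 = from-yes (0ℚ ≤? 1ℚ)

  1≰0 : ¬ 1ℚ ≤ 0ℚ
  1≰0 = from-no (1ℚ ≤? 0ℚ)

  1≢0 : 1ℚ ≢ 0ℚ
  1≢0 ()

  𝟙 : Subset m → Fin m → ℚ
  𝟙 X e = if does (e ∈? X) then 1ℚ else 0ℚ

  module _ {X : Subset m} where

    𝟙-∈ : ∀ {x} → x ∈ X → 𝟙 X x ≡ 1ℚ
    𝟙-∈ {x} x∈X with x ∈? X
    ... | yes _ = refl
    ... | no x∉X = contradiction x∈X x∉X

    𝟙-∉ : ∀ {x} → x ∉ X → 𝟙 X x ≡ 0ℚ
    𝟙-∉ {x} x∉X with x ∈? X
    ... | yes x∈X = contradiction x∈X x∉X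
    ... | no _ = refl

    0≤𝟙 : ∀ x → 0ℚ ≤ 𝟙 X x
    0≤𝟙 x with x ∈? X
    ... | yes _ = 0≤1
    ... | no _ = ≤-refl

    𝟙-mono : ∀ {x x′ : Fin m} → (x ∈ X → x′ ∈ X) → 𝟙 X x ≤ 𝟙 X x′
    𝟙-mono {x} {x′} x∈⇒x′∈ with x ∈? X | x′ ∈? X
    ... | yes _ | yes _ = ≤-refl
    ... | yes x∈X | no x′∉X = contradiction (x∈⇒x′∈ x∈X) x′∉X
    ... | no _ | yes _ = 0≤1
    ... | no _ | no _ = ≤-refl

  module _ {n m : ℕ} (H : Graph n m) where
    open PreBracketing

    private
      variable
        P Q : PreBracketing H
        Bs : Subset m → Bool
        S Z μ : Subset m
        e f : Fin m
        y : Vect H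

    𝟙-¬GeB : ∀ {X} → cone H Bs (𝟙 X) → e ∉ X → f ∈ X → ¬ GeB H Bs e f
    𝟙-¬GeB monotone e∉X f∈X e≥f = 1≰0 (subst₂ _≤_ (𝟙-∈ f∈X) (𝟙-∉ e∉X) (monotone _ _ e≥f))

    VanishesOn : Subset m → Pred (Vect H) 0ℓ
    VanishesOn Z y = ∀ e → e ∈ Z → y e ≡ 0ℚ

    posCone⇒≥0 : ∀ P → posCone H P y → ∀ e → 0ℚ ≤ y e
    posCone⇒≥0 {y} P (vanish , nonneg , _) e with e ∈? K P
    ... | yes e∈K = subst (0ℚ ≤_) (sym (vanish e e∈K)) ≤-refl
    ... | no e∉K = nonneg e e∉K

    𝟙-∁K─Z∈posCone : ∀ P → DownClosed H (B P) Z → posCone H P (𝟙 (∁ (K P) ─ Z))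
    𝟙-∁K─Z∈posCone {Z} P down = vanish , (λ e _ → 0≤𝟙 e) , monotone
      where
      open PreBracketingProperties H P
      X = ∁ (K P) ─ Z
      vanish : ∀ e → e ∈ K P → 𝟙 X e ≡ 0ℚ
      vanish e e∈K = 𝟙-∉ (x∈p⇒x∉∁p e∈K ∘ p─q⊆p _ Z)
      monotone : cone H (B P) (𝟙 X)
      monotone a b a≥b =
        𝟙-mono (λ b∈X → x∈p∧x∉q⇒x∈p─q (x∉p⇒x∈∁p (GeB⇒∉K a≥b)) (x∈p─q⇒x∉q b∈X ∘ down a≥b))

    -- Each consequence of posCone P ⊆ posCone Q is witnessed by one test vector 𝟙 (∁ (K P) ─ Z).
    module _ (P Q : PreBracketing H) (P⊆Q : posCone H P U.⊆ posCone H Q) where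
      private
        module p = PreBracketingProperties H P
        module q = PreBracketingProperties H Q

        ∁K : Subset m
        ∁K = ∁ (K P) ─ ⊥

        ∉K⇒∈∁K : e ∉ K P → e ∈ ∁K
        ∉K⇒∈∁K e∉K = x∈p∧x∉q⇒x∈p─q (x∉p⇒x∈∁p e∉K) ∉⊥

        𝟙∁K∈Q : posCone H Q (𝟙 ∁K)
        𝟙∁K∈Q = P⊆Q (𝟙-∁K─Z∈posCone P (λ _ a∈⊥ → contradiction a∈⊥ ∉⊥))

      posCone-⊆⇒KQ⊆KP : K Q ⊆ K P
      posCone-⊆⇒KQ⊆KP {e} e∈KQ with e ∈? K P
      ... | yes e∈KP = e∈KP
      ... | no e∉KP = contradiction (trans (sym (𝟙-∈ (∉K⇒∈∁K e∉KP))) (proj₁ 𝟙∁K∈Q e e∈KQ)) 1≢0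

      posCone-⊆⇒¬GeB : e ∈ K P → f ∉ K P → ¬ GeB H (B Q) e f
      posCone-⊆⇒¬GeB e∈K f∉K =
        𝟙-¬GeB (proj₂ (proj₂ 𝟙∁K∈Q)) (x∈p⇒x∉∁p e∈K ∘ p─q⊆p _ ⊥) (∉K⇒∈∁K f∉K)

      posCone-⊆⇒GeB : e ∉ K P → f ∉ K P → GeB H (B Q) e f → GeB H (B P) e f
      posCone-⊆⇒GeB {e} {f} e∉K f∉K e≥f with f ∈? p.br e∉K
      ... | yes f∈βe = p.∈br⇒GeB (p.br-IsBr e∉K) f∈βe
      ... | no f∉βe = ⊥-elim (𝟙-¬GeB (proj₂ (proj₂ 𝟙X∈Q)) e∉X f∈X e≥f)
        where
        X = ∁ (K P) ─ p.br e∉K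
        𝟙X∈Q = P⊆Q (𝟙-∁K─Z∈posCone P (p.br-DownClosed e∉K))
        e∉X : e ∉ X
        e∉X e∈X = x∈p─q⇒x∉q e∈X (p.∈br e∉K)
        f∈X : f ∈ X
        f∈X = x∈p∧x∉q⇒x∈p─q (x∉p⇒x∈∁p f∉K) f∉βe

      posCone-⊆⇒BP⊆BQ : K P ≡ K Q → B P S ≡ true → B Q S ≡ true
      posCone-⊆⇒BP⊆BQ {S} KP≡KQ S∈P =
        q.brs⊆⇒∈B (subst (λ K → IsBracket H K S) KP≡KQ (p.bracket S∈P)) brs⊆S
        where
        brs⊆S : ∀ {g β} → g ∈ S → IsBr H (B Q) g β → β ⊆ S
        brs⊆S g∈S g-br h∈β =
          p.br-least g∉K S∈P g∈S
            (p.GeB⇒∈br (posCone-⊆⇒GeB g∉K h∉K (q.∈br⇒GeB g-br h∈β)) (p.br-IsBr g∉K))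
          where
          g∉K = p.∉K S∈P g∈S
          h∉K = subst (_ ∉_) (sym KP≡KQ) (q.∉K (proj₁ g-br) h∈β)

  -- The order implies inclusion; contraction of a minimal bracket

  module _ {n m : ℕ} (H : Graph n m) where
    open PreBracketing

    private
      variable
        P Q : PreBracketing H
        S β γ μ : Subset m
        e f : Fin m
        u v : Fin n
        y : Vect H

    posCone-mono : ∀ P Q → K P ≡ K Q → (∀ {S} → B P S ≡ true → B Q S ≡ true) →
                   posCone H P U.⊆ posCone H Q
    posCone-mono P Q KP≡KQ P⊆Q (vanish , nonneg , monotone) =
      (λ e e∈KQ → vanish e (subst (e ∈_) (sym KP≡KQ) e∈KQ)) ,
      (λ e e∉KQ → nonneg e (subst (e ∉_) (sym KP≡KQ) e∉KQ)) ,
      (λ e f e≥f → monotone e f (GeB-P e≥f))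
      where
      module p = PreBracketingProperties H P
      module q = PreBracketingProperties H Q
      GeB-P : GeB H (B Q) e f → GeB H (B P) e f
      GeB-P {e} e≥f@(_ , _ , e-br@(_ , _ , least) , _) =
        p.∈br⇒GeB (p.br-IsBr e∉KP) (least _ (P⊆Q (p.br∈B e∉KP)) (p.∈br e∉KP) (q.GeB⇒∈br e≥f e-br))
        where e∉KP = subst (e ∉_) (sym KP≡KQ) (q.GeB⇒∉K e≥f)

    IsContraction : PreBracketing H → PreBracketing H → Subset m → Set
    IsContraction P Q μ =
      B Q μ ≡ true × (∀ β → B Q β ≡ true → β ⊆ μ → β ≡ μ) × K P ≡ K Q ∪ μ ×
      (∀ S → (B P S ≡ true) ⇔ (∃[ β ] (B Q β ≡ true × β ≢ μ × S ≡ β ─ μ)))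

    module Contraction (P Q : PreBracketing H) (μ : Subset m) (contraction : IsContraction P Q μ) where
      private
        module p = PreBracketingProperties H P
        module q = PreBracketingProperties H Q
        μ∈Q = proj₁ contraction
        μ-minimal = proj₁ (proj₂ contraction)
        KP≡KQ∪μ = proj₁ (proj₂ (proj₂ contraction))
        ∈P⇔ = proj₂ (proj₂ (proj₂ contraction))

      ∈KP⁺ : e ∈ K Q ⊎ e ∈ μ → e ∈ K P
      ∈KP⁺ e∈ = subst (_ ∈_) (sym KP≡KQ∪μ) (x∈p∪q⁺ e∈)

      ∈KP⁻ : e ∈ K P → e ∈ K Q ⊎ e ∈ μ
      ∈KP⁻ e∈ = x∈p∪q⁻ _ _ (subst (_ ∈_) KP≡KQ∪μ e∈)

      KQ⊂KP : K Q ⊂ K P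
      KQ⊂KP with proj₁ (proj₂ (q.bracket μ∈Q))
      ... | g , g∈μ = (λ e∈KQ → ∈KP⁺ (inj₁ e∈KQ)) , g , ∈KP⁺ (inj₂ g∈μ) , q.∉K μ∈Q g∈μ

      IsBr-contraction : IsBr H (B Q) e β → e ∉ μ → IsBr H (B P) e (β ─ μ)
      IsBr-contraction {e} {β} (β∈Q , e∈β , least) e∉μ =
        from (∈P⇔ _) (β , β∈Q , β≢μ , refl) , x∈p∧x∉q⇒x∈p─q e∈β e∉μ , least′
        where
        β≢μ : β ≢ μ
        β≢μ β≡μ = e∉μ (subst (e ∈_) β≡μ e∈β)
        least′ : ∀ β′ → B P β′ ≡ true → e ∈ β′ → β ─ μ ⊆ β′
        least′ β′ β′∈P e∈β′ with to (∈P⇔ β′) β′∈P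
        ... | γ , γ∈Q , _ , refl = p⊆q⇒p─r⊆q─r (least γ γ∈Q (p─q⊆p γ μ e∈β′))

      GeB-contraction⁻ : GeB H (B P) e f → GeB H (B Q) e f
      GeB-contraction⁻ e≥f =
        q.∈br⇒GeB (q.br-IsBr e∉KQ) (p─q⊆p _ μ (p.GeB⇒∈br e≥f (IsBr-contraction (q.br-IsBr e∉KQ) e∉μ)))
        where
        e∉KP = p.GeB⇒∉K e≥f
        e∉KQ : _ ∉ K Q
        e∉KQ e∈KQ = e∉KP (∈KP⁺ (inj₁ e∈KQ))
        e∉μ : _ ∉ μ
        e∉μ e∈μ = e∉KP (∈KP⁺ (inj₂ e∈μ))

      GeB-contraction⁺ : GeB H (B Q) e f → f ∉ μ → GeB H (B P) e f
      GeB-contraction⁺ {e} {f} e≥f@(βe , βf , e-br@(βe∈Q , _ , least) , f-br , βf⊆βe) f∉μ =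
        βe ─ μ , βf ─ μ , IsBr-contraction e-br e∉μ , IsBr-contraction f-br f∉μ ,
        p⊆q⇒p─r⊆q─r βf⊆βe
        where
        e∉μ : e ∉ μ
        e∉μ e∈μ = f∉μ (subst (f ∈_) (μ-minimal βe βe∈Q (least μ μ∈Q e∈μ)) (q.GeB⇒∈br e≥f e-br))

      posCone-contraction-⊆ : posCone H P U.⊆ posCone H Q
      posCone-contraction-⊆ {y} y∈P@(vanish , _ , monotone) =
        (λ e e∈KQ → vanish e (∈KP⁺ (inj₁ e∈KQ))) , (λ e _ → posCone⇒≥0 H P y∈P e) , monotone′
        where
        monotone′ : cone H (B Q) y
        monotone′ e f e≥f with f ∈? μ
        ... | yes f∈μ = subst (_≤ y e) (sym (vanish f (∈KP⁺ (inj₂ f∈μ)))) (posCone⇒≥0 H P y∈P e)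
        ... | no f∉μ = monotone e f (GeB-contraction⁺ e≥f f∉μ)

      posCone-contraction-⊇ : posCone H Q U.∩ VanishesOn H μ U.⊆ posCone H P
      posCone-contraction-⊇ ((vanish , nonneg , monotone) , vanish-μ) =
        (λ e e∈KP → [ vanish e , vanish-μ e ]′ (∈KP⁻ e∈KP)) ,
        (λ e e∉KP → nonneg e (λ e∈KQ → e∉KP (∈KP⁺ (inj₁ e∈KQ)))) ,
        (λ e f e≥f → monotone e f (GeB-contraction⁻ e≥f))

    step⇒posCone-⊆ : ∀ P Q → _≈P_ H P Q ⊎ _⋖_ H P Q → posCone H P U.⊆ posCone H Q
    step⇒posCone-⊆ P Q (inj₁ (KP≡KQ , BP≗BQ)) =
      posCone-mono P Q KP≡KQ (λ {S} S∈P → trans (sym (BP≗BQ S)) S∈P)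
    step⇒posCone-⊆ P Q (inj₂ (inj₁ (KP≡KQ , _ , _ , _ , ∈P⇔))) =
      posCone-mono P Q KP≡KQ (λ {S} S∈P → proj₁ (to (∈P⇔ S) S∈P))
    step⇒posCone-⊆ P Q (inj₂ (inj₂ (μ , contraction))) = Contraction.posCone-contraction-⊆ P Q μ contraction

    ≤P⇒posCone-⊆ : ∀ P Q → _≤P_ H P Q → posCone H P U.⊆ posCone H Q
    ≤P⇒posCone-⊆ P .P ε y∈P = y∈P
    ≤P⇒posCone-⊆ P Q (_◅_ {j = R} step steps) y∈P =
      ≤P⇒posCone-⊆ R Q steps (step⇒posCone-⊆ P R step y∈P)

    module _ (Q : PreBracketing H) {μ} (μ∈Q : B Q μ ≡ true)
             (μ-minimal : ∀ β → B Q β ≡ true → β ⊆ μ → β ≡ μ) where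
      private
        module q = PreBracketingProperties H Q

        μ⊆-if-touching : B Q β ≡ true → β ≢ μ → e ∈ β → Endpoint H e u → Incident H (K Q) μ u →
                         μ ⊆ β
        μ⊆-if-touching β∈Q β≢μ e∈β eu (g , z , g∈μ , gz , z⋆u)
          with q.ShareVertex⇒nested β∈Q μ∈Q (_ , g , _ , z , e∈β , g∈μ , eu , gz , Reach-sym H z⋆u)
        ... | inj₁ β⊆μ = contradiction (μ-minimal _ β∈Q β⊆μ) β≢μ
        ... | inj₂ μ⊆β = μ⊆β

        bracket/μ : B Q β ≡ true → β ≢ μ → IsBracket H (K Q ∪ μ) (β ─ μ)
        bracket/μ {β} β∈Q β≢μ = disjoint , nonempty , connected
          where
          disjoint : ∀ e → e ∈ β ─ μ → e ∉ K Q ∪ μ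
          disjoint e e∈ e∈K∪μ = [ q.∉K β∈Q (p─q⊆p β μ e∈) , x∈p─q⇒x∉q e∈ ]′ (x∈p∪q⁻ _ _ e∈K∪μ)
          nonempty : Nonempty (β ─ μ)
          nonempty with ⊆-or-∉ β μ
          ... | inj₁ β⊆μ = contradiction (μ-minimal β β∈Q β⊆μ) β≢μ
          ... | inj₂ (e , e∈β , e∉μ) = e , x∈p∧x∉q⇒x∈p─q e∈β e∉μ
          connected : ∀ e f x y → e ∈ β ─ μ → f ∈ β ─ μ → Endpoint H e x → Endpoint H f y →
                      Reach H ((β ─ μ) ∪ (K Q ∪ μ)) x y
          connected e f x y e∈ f∈ ex fy =
            Reach-mono H p∪q⊆[p─r]∪[q∪r]
              (proj₂ (proj₂ (q.bracket β∈Q)) e f x y (p─q⊆p β μ e∈) (p─q⊆p β μ f∈) ex fy)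

        compatible/μ : B Q β ≡ true → β ≢ μ → B Q γ ≡ true → γ ≢ μ →
                       Compatible H (K Q ∪ μ) (β ─ μ) (γ ─ μ)
        compatible/μ {β} {γ} β∈Q β≢μ γ∈Q γ≢μ with q.compatible β∈Q γ∈Q
        ... | inj₁ (inj₁ β⊆γ) = inj₁ (inj₁ (p⊆q⇒p─r⊆q─r β⊆γ))
        ... | inj₁ (inj₂ γ⊆β) = inj₁ (inj₂ (p⊆q⇒p─r⊆q─r γ⊆β))
        ... | inj₂ (no-edge , no-vertex) = inj₂ (no-edge/μ , no-vertex/μ)
          where
          no-edge/μ : ¬ ShareEdge H (β ─ μ) (γ ─ μ)
          no-edge/μ (e , e∈β─μ , e∈γ─μ) = no-edge (e , p─q⊆p β μ e∈β─μ , p─q⊆p γ μ e∈γ─μ)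
          no-vertex/μ : ¬ ShareVertex H (K Q ∪ μ) (β ─ μ) (γ ─ μ)
          no-vertex/μ (e , f , x , y , e∈ , f∈ , ex , fy , x⋆y)
            with Reach-∪⁻ H x⋆y | Reach-∪⁻ H (Reach-sym H x⋆y)
          ... | inj₁ x⋆y′ | _ =
            no-vertex (e , f , x , y , p─q⊆p β μ e∈ , p─q⊆p γ μ f∈ , ex , fy , x⋆y′)
          ... | _ | inj₁ y⋆x′ =
            no-vertex (e , f , x , y , p─q⊆p β μ e∈ , p─q⊆p γ μ f∈ , ex , fy , Reach-sym H y⋆x′)
          ... | inj₂ x∼μ | inj₂ y∼μ =
            let g , g∈μ = proj₁ (proj₂ (q.bracket μ∈Q)) in
            no-edge (g , μ⊆-if-touching β∈Q β≢μ (p─q⊆p β μ e∈) ex x∼μ g∈μ ,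
                         μ⊆-if-touching γ∈Q γ≢μ (p─q⊆p γ μ f∈) fy y∼μ g∈μ)

        top/μ : (∃[ e ] e ∉ K Q ∪ μ) → ∃[ β ] (B Q β ≡ true × β ≢ μ × ∁ (K Q ∪ μ) ≡ β ─ μ)
        top/μ (e , e∉) = ∁ (K Q) , q.top (e , e∉KQ) , ∁KQ≢μ , ∁[p∪q]≡∁p─q (K Q) μ
          where
          e∉KQ = e∉ ∘ p⊆p∪q μ
          ∁KQ≢μ : ∁ (K Q) ≢ μ
          ∁KQ≢μ ∁KQ≡μ = e∉ (q⊆p∪q (K Q) μ (subst (e ∈_) ∁KQ≡μ (x∉p⇒x∈∁p e∉KQ)))

      ContractedBracket : Pred (Subset m) 0ℓ
      ContractedBracket S = ∃[ β ] (B Q β ≡ true × β ≢ μ × S ≡ β ─ μ)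

      ContractedBracket? : Decidable ContractedBracket
      ContractedBracket? S = anySubset? (λ β → B Q β ≟ᵇ true ×-dec ¬? (β ≟ˢ μ) ×-dec S ≟ˢ β ─ μ)

      contraction : PreBracketing H
      contraction = preBr (K Q ∪ μ) (does ∘ ContractedBracket?)
        (IsBracketing-does H (K Q ∪ μ) ContractedBracket?
          (λ { (β , β∈Q , β≢μ , refl) → bracket/μ β∈Q β≢μ })
          (λ { (β , β∈Q , β≢μ , refl) (γ , γ∈Q , γ≢μ , refl) → compatible/μ β∈Q β≢μ γ∈Q γ≢μ })
          top/μ)

      contraction-IsContraction : IsContraction contraction Q μ
      contraction-IsContraction =
        μ∈Q , μ-minimal , refl , λ S → mk⇔ (does-true⇒ (ContractedBracket? S)) (dec-true (ContractedBracket? S))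

    contraction-inside : ∀ Q {β} → B Q β ≡ true → ∃[ μ ] ∃[ Q′ ] (μ ⊆ β × IsContraction Q′ Q μ)
    contraction-inside Q β∈Q with PreBracketingProperties.minimal-⊆ H Q β∈Q
    ... | μ , μ∈Q , μ⊆β , μ-minimal =
      μ , contraction Q μ∈Q μ-minimal , μ⊆β , contraction-IsContraction Q μ∈Q μ-minimal

  -- Inclusion implies the order

  module _ {n m : ℕ} (H : Graph n m) where
    open PreBracketing

    ≈P-intro : ∀ P Q → K P ≡ K Q → (∀ S → B P S ≡ true ⇔ B Q S ≡ true) → _≈P_ H P Q
    ≈P-intro P Q KP≡KQ B⇔B = KP≡KQ , λ S → ⇔→≡ (B⇔B S)

    -- keeping Ls interpolates between P (Ls = []) and Q (Ls = allSubsets m); consecutive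
    -- steps either agree or differ by the removal of one bracket.
    module Removal (P Q : PreBracketing H) (KP≡KQ : K P ≡ K Q)
                   (P⊆Q : ∀ {S} → B P S ≡ true → B Q S ≡ true) where
      private
        module p = PreBracketingProperties H P
        module q = PreBracketingProperties H Q

        ∁KQ∈P : (∃[ e ] e ∉ K Q) → B P (∁ (K Q)) ≡ true
        ∁KQ∈P (e , e∉KQ) =
          subst (λ K → B P (∁ K) ≡ true) KP≡KQ (p.top (e , subst (e ∉_) (sym KP≡KQ) e∉KQ))

      Kept : List (Subset m) → Pred (Subset m) 0ℓ
      Kept Ls S = B Q S ≡ true × (B P S ≡ true ⊎ S ∈ₗ Ls)

      Kept? : ∀ Ls → Decidable (Kept Ls)
      Kept? Ls S = B Q S ≟ᵇ true ×-dec (B P S ≟ᵇ true ⊎-dec Any.any? (S ≟ˢ_) Ls)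

      keeping : List (Subset m) → PreBracketing H
      keeping Ls = preBr (K Q) (does ∘ Kept? Ls)
        (IsBracketing-does H (K Q) (Kept? Ls) (λ (S∈Q , _) → q.bracket S∈Q)
          (λ (S∈Q , _) (T∈Q , _) → q.compatible S∈Q T∈Q)
          (λ nonempty → q.top nonempty , inj₁ (∁KQ∈P nonempty)))

      private
        keeping⁺ : ∀ Ls {S} → Kept Ls S → B (keeping Ls) S ≡ true
        keeping⁺ Ls {S} = dec-true (Kept? Ls S)

        keeping⁻ : ∀ Ls {S} → B (keeping Ls) S ≡ true → Kept Ls S
        keeping⁻ Ls {S} = does-true⇒ (Kept? Ls S)

        Kept-∷⁻ : ∀ {S Ls T} → Kept (S ∷ Ls) T → Kept Ls T ⊎ T ≡ S
        Kept-∷⁻ (T∈Q , inj₁ T∈P) = inj₁ (T∈Q , inj₁ T∈P)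
        Kept-∷⁻ (_ , inj₂ (here T≡S)) = inj₂ T≡S
        Kept-∷⁻ (T∈Q , inj₂ (there T∈Ls)) = inj₁ (T∈Q , inj₂ T∈Ls)

        Kept-∷⁺ : ∀ {S Ls T} → Kept Ls T → Kept (S ∷ Ls) T
        Kept-∷⁺ (T∈Q , T∈P⊎Ls) = T∈Q , [ inj₁ , inj₂ ∘ there ]′ T∈P⊎Ls

        unchanged : ∀ S Ls → (Kept (S ∷ Ls) S → Kept Ls S) → _≈P_ H (keeping Ls) (keeping (S ∷ Ls))
        unchanged S Ls S-kept = ≈P-intro (keeping Ls) (keeping (S ∷ Ls)) refl λ T →
          mk⇔ (keeping⁺ (S ∷ Ls) ∘ Kept-∷⁺ ∘ keeping⁻ Ls) (keeping⁺ Ls ∘ kept ∘ keeping⁻ (S ∷ Ls))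
          where
          kept : ∀ {T} → Kept (S ∷ Ls) T → Kept Ls T
          kept T-kept with Kept-∷⁻ T-kept
          ... | inj₁ T-kept′ = T-kept′
          ... | inj₂ refl = S-kept T-kept

      P≈keeping[] : _≈P_ H P (keeping [])
      P≈keeping[] = ≈P-intro P (keeping []) KP≡KQ λ S →
        mk⇔ (λ S∈P → keeping⁺ [] (P⊆Q S∈P , inj₁ S∈P))
            (λ S∈ → [ id , (λ ()) ]′ (proj₂ (keeping⁻ [] S∈)))

      keeping-all≈Q : _≈P_ H (keeping (allSubsets m)) Q
      keeping-all≈Q = ≈P-intro (keeping (allSubsets m)) Q refl λ S →
        mk⇔ (proj₁ ∘ keeping⁻ (allSubsets m))
            (λ S∈Q → keeping⁺ (allSubsets m) (S∈Q , inj₂ (∈-allSubsets S)))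

      keeping-∷ : ∀ S Ls → _≈P_ H (keeping Ls) (keeping (S ∷ Ls)) ⊎ _⋖_ H (keeping Ls) (keeping (S ∷ Ls))
      keeping-∷ S Ls with Kept? Ls S | B Q S ≟ᵇ true
      ... | yes S-kept | _ = inj₁ (unchanged S Ls (λ _ → S-kept))
      ... | no S-dropped | no S∉Q = inj₁ (unchanged S Ls (λ (S∈Q , _) → contradiction S∈Q S∉Q))
      ... | no S-dropped | yes S∈Q =
        inj₂ (inj₁ (refl , S , keeping⁺ (S ∷ Ls) (S∈Q , inj₂ (here refl)) , S≢∁KQ , removed))
        where
        S≢∁KQ : S ≢ ∁ (K Q)
        S≢∁KQ S≡∁KQ =
          S-dropped (S∈Q , inj₁ (subst (λ X → B P X ≡ true) (sym S≡∁KQ) (∁KQ∈P (e , q.∉K S∈Q e∈S))))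
          where
          e = proj₁ (proj₁ (proj₂ (q.bracket S∈Q)))
          e∈S = proj₂ (proj₁ (proj₂ (q.bracket S∈Q)))
        removed : ∀ T → B (keeping Ls) T ≡ true ⇔ (B (keeping (S ∷ Ls)) T ≡ true × T ≢ S)
        removed T = mk⇔
          (λ T∈ → keeping⁺ (S ∷ Ls) (Kept-∷⁺ (keeping⁻ Ls T∈)) ,
                  λ T≡S → S-dropped (subst (Kept Ls) T≡S (keeping⁻ Ls T∈)))
          (λ (T∈ , T≢S) →
            keeping⁺ Ls ([ id , (λ T≡S → contradiction T≡S T≢S) ]′ (Kept-∷⁻ (keeping⁻ (S ∷ Ls) T∈))))

      keeping-≤P : ∀ Ls → _≤P_ H (keeping []) (keeping Ls)
      keeping-≤P [] = ε
      keeping-≤P (S ∷ Ls) = keeping-≤P Ls ◅◅ (keeping-∷ S Ls ◅ ε)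

      B⊆⇒≤P : _≤P_ H P Q
      B⊆⇒≤P = inj₁ P≈keeping[] ◅ (keeping-≤P (allSubsets m) ◅◅ (inj₁ keeping-all≈Q ◅ ε))

    -- If K P = K Q, the brackets of P are brackets of Q.  Otherwise
    -- br_Q e ⊆ K P for some e ∈ K P ∖ K Q, so a minimal bracket of Q inside it can be
    -- contracted without leaving posCone P.
    posCone-⊆⇒≤P : ∀ P Q → posCone H P U.⊆ posCone H Q → _≤P_ H P Q
    posCone-⊆⇒≤P P Q = go P Q (⊃-wellFounded (K Q))
      where
      go : ∀ P Q → Acc _⊃_ (K Q) → posCone H P U.⊆ posCone H Q → _≤P_ H P Q
      go P Q (acc rec) P⊆Q with ⊆-or-∉ (K P) (K Q)
      ... | inj₁ KP⊆KQ = Removal.B⊆⇒≤P P Q KP≡KQ (posCone-⊆⇒BP⊆BQ H P Q P⊆Q KP≡KQ)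
        where KP≡KQ = ⊆-antisym KP⊆KQ (posCone-⊆⇒KQ⊆KP H P Q P⊆Q)
      ... | inj₂ (e , e∈KP , e∉KQ) = contract (contraction-inside H Q (q.br∈B e∉KQ))
        where
        module q = PreBracketingProperties H Q
        βe⊆KP : q.br e∉KQ ⊆ K P
        βe⊆KP {f} f∈βe with f ∈? K P
        ... | yes f∈KP = f∈KP
        ... | no f∉KP =
          contradiction (q.∈br⇒GeB (q.br-IsBr e∉KQ) f∈βe) (posCone-⊆⇒¬GeB H P Q P⊆Q e∈KP f∉KP)
        contract : ∃[ μ ] ∃[ Q′ ] (μ ⊆ q.br e∉KQ × IsContraction H Q′ Q μ) → _≤P_ H P Q
        contract (μ , Q′ , μ⊆βe , Q′-contraction) =
          go P Q′ (rec KQ⊂KP) P⊆Q′ ◅◅ (inj₂ (inj₂ (μ , Q′-contraction)) ◅ ε)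
          where
          open Contraction H Q′ Q μ Q′-contraction
          P⊆Q′ : posCone H P U.⊆ posCone H Q′
          P⊆Q′ y∈P = posCone-contraction-⊇ (P⊆Q y∈P , λ f f∈μ → proj₁ y∈P f (βe⊆KP (μ⊆βe f∈μ)))

    posCone-injective : ∀ P Q → posCone H P U.≐ posCone H Q → _≈P_ H P Q
    posCone-injective P Q (P⊆Q , Q⊆P) = ≈P-intro P Q KP≡KQ λ S →
      mk⇔ (posCone-⊆⇒BP⊆BQ H P Q P⊆Q KP≡KQ) (posCone-⊆⇒BP⊆BQ H Q P Q⊆P (sym KP≡KQ))
      where KP≡KQ = ⊆-antisym (posCone-⊆⇒KQ⊆KP H Q P Q⊆P) (posCone-⊆⇒KQ⊆KP H P Q P⊆Q)

  -- Cones of the fan are positive cones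

  module _ {n m : ℕ} (H : Graph n m) where
    open PreBracketing

    contraction-onto : ∀ Q {Z} → K Q ⊆ Z → DownClosed H (B Q) Z →
                       ∃[ Q* ] (posCone H Q* U.≐ posCone H Q U.∩ VanishesOn H Z)
    contraction-onto Q {Z} = go Q (⊃-wellFounded (K Q))
      where
      go : ∀ Q → Acc _⊃_ (K Q) → K Q ⊆ Z → DownClosed H (B Q) Z →
           ∃[ Q* ] (posCone H Q* U.≐ posCone H Q U.∩ VanishesOn H Z)
      go Q (acc rec) KQ⊆Z Z-down with ⊆-or-∉ Z (K Q)
      ... | inj₁ Z⊆KQ = Q , (λ y∈Q → y∈Q , λ e e∈Z → proj₁ y∈Q e (Z⊆KQ e∈Z)) , proj₁
      ... | inj₂ (e , e∈Z , e∉KQ) = step (contraction-inside H Q (q.br∈B e∉KQ))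
        where
        module q = PreBracketingProperties H Q
        step : ∃[ μ ] ∃[ Q′ ] (μ ⊆ q.br e∉KQ × IsContraction H Q′ Q μ) →
               ∃[ Q* ] (posCone H Q* U.≐ posCone H Q U.∩ VanishesOn H Z)
        step (μ , Q′ , μ⊆βe , Q′-contraction) =
          let Q* , Q*≐Q′∩Z = go Q′ (rec KQ⊂KP) KQ′⊆Z Z-down′
          in Q* , ≐-trans Q*≐Q′∩Z (Q′∩Z⊆Q∩Z , Q∩Z⊆Q′∩Z)
          where
          open Contraction H Q′ Q μ Q′-contraction
          μ⊆Z : μ ⊆ Z
          μ⊆Z f∈μ = Z-down (q.∈br⇒GeB (q.br-IsBr e∉KQ) (μ⊆βe f∈μ)) e∈Z
          KQ′⊆Z : K Q′ ⊆ Z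
          KQ′⊆Z f∈KQ′ = [ KQ⊆Z , μ⊆Z ]′ (∈KP⁻ f∈KQ′)
          Z-down′ : DownClosed H (B Q′) Z
          Z-down′ a≥b = Z-down (GeB-contraction⁻ a≥b)
          Q′∩Z⊆Q∩Z : posCone H Q′ U.∩ VanishesOn H Z U.⊆ posCone H Q U.∩ VanishesOn H Z
          Q′∩Z⊆Q∩Z (y∈Q′ , y-vanishes) = posCone-contraction-⊆ y∈Q′ , y-vanishes
          Q∩Z⊆Q′∩Z : posCone H Q U.∩ VanishesOn H Z U.⊆ posCone H Q′ U.∩ VanishesOn H Z
          Q∩Z⊆Q′∩Z (y∈Q , y-vanishes) =
            posCone-contraction-⊇ (y∈Q , λ f f∈μ → y-vanishes f (μ⊆Z f∈μ)) , y-vanishes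

    -- y vanishes on the edges ↓F below F, and contracting ↓F realises the face.
    fanCone⇒posCone : ∀ Bk F → ∃[ P ] (posCone H P U.≐ fanCone H Bk F)
    fanCone⇒posCone (Bs , ok) F =
      let P* , P*≐P₀∩↓F = contraction-onto P₀ (λ e∈⊥ → contradiction e∈⊥ ∉⊥) ↓F-down
      in P* , ≐-trans P*≐P₀∩↓F (P₀∩↓F⊆fan , fan⊆P₀∩↓F)
      where
      P₀ = preBr ⊥ Bs ok
      open PreBracketingProperties H P₀

      Below : Pred (Fin m) 0ℓ
      Below e = ∃[ f ] (f ∈ F × e ∈ br {e = f} ∉⊥)

      Below? : Decidable Below
      Below? e = any? (λ f → f ∈? F ×-dec e ∈? br {e = f} ∉⊥)

      ↓F : Subset m
      ↓F = toSubset Below?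

      ↓F⁺ : ∀ {e} → Below e → e ∈ ↓F
      ↓F⁺ = ∈-toSubset⁺ Below?

      ↓F⁻ : ∀ {e} → e ∈ ↓F → Below e
      ↓F⁻ = ∈-toSubset⁻ Below?

      ↓F-down : DownClosed H Bs ↓F
      ↓F-down a≥b a∈↓F with ↓F⁻ a∈↓F
      ... | f , f∈F , a∈βf = ↓F⁺ (f , f∈F , br-DownClosed ∉⊥ a≥b a∈βf)

      P₀∩↓F⊆fan : posCone H P₀ U.∩ VanishesOn H ↓F U.⊆ fanCone H (Bs , ok) F
      P₀∩↓F⊆fan (y∈P₀@(_ , _ , monotone) , y-vanishes) =
        monotone , posCone⇒≥0 H P₀ y∈P₀ , λ f f∈F → y-vanishes f (↓F⁺ (f , f∈F , ∈br ∉⊥))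

      fan⊆P₀∩↓F : fanCone H (Bs , ok) F U.⊆ posCone H P₀ U.∩ VanishesOn H ↓F
      fan⊆P₀∩↓F {y} (monotone , nonneg , vanish) =
        ((λ e e∈⊥ → contradiction e∈⊥ ∉⊥) , (λ e _ → nonneg e) , monotone) , y-vanishes
        where
        y-vanishes : VanishesOn H ↓F y
        y-vanishes e e∈↓F with ↓F⁻ e∈↓F
        ... | f , f∈F , e∈βf =
          ≤-antisym (subst (y e ≤_) (vanish f f∈F) (monotone f e (∈br⇒GeB (br-IsBr ∉⊥) e∈βf))) (nonneg e)

  -- Positive cones are cones of the fan

  module _ {n m : ℕ} (H : Graph n m) (P : PreBracketing H) where
    open Graph H
    open PreBracketing P
    open PreBracketingProperties H P

    private
      variable
        S S′ T T′ : Subset m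
        e f g k : Fin m
        u v x y : Fin n

    Attached : Subset m → Pred (Fin m) 0ℓ
    Attached S g = g ∈ K × Incident H K S (src g)

    Attached? : ∀ S → Decidable (Attached S)
    Attached? S g = g ∈? K ×-dec Incident? H K S (src g)

    -- The preimage in H of the subgraph S of H / K: S and the edges of the components of K
    -- that it touches.
    lift : Subset m → Subset m
    lift S = S ∪ toSubset (Attached? S)

    ∈lift⁺ : g ∈ S → g ∈ lift S
    ∈lift⁺ = p⊆p∪q _

    ∈lift-Attached⁺ : Attached S g → g ∈ lift S
    ∈lift-Attached⁺ {S} = q⊆p∪q S _ ∘ ∈-toSubset⁺ (Attached? S)

    ∈lift⁻ : g ∈ lift S → g ∈ S ⊎ Attached S g
    ∈lift⁻ {S = S} = Sum.map₂ (∈-toSubset⁻ (Attached? S)) ∘ x∈p∪q⁻ S _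

    lift-∉K : g ∈ lift S → g ∉ K → g ∈ S
    lift-∉K g∈ g∉K = [ id , (λ (g∈K , _) → contradiction g∈K g∉K) ]′ (∈lift⁻ g∈)

    lift-mono : S ⊆ S′ → lift S ⊆ lift S′
    lift-mono S⊆S′ g∈ with ∈lift⁻ g∈
    ... | inj₁ g∈S = ∈lift⁺ (S⊆S′ g∈S)
    ... | inj₂ (g∈K , s , x , s∈S , sx , x⋆src) = ∈lift-Attached⁺ (g∈K , s , x , S⊆S′ s∈S , sx , x⋆src)

    lift-Endpoint : g ∈ lift S → Endpoint H g x → Incident H K S x
    lift-Endpoint g∈ gx with ∈lift⁻ g∈
    ... | inj₁ g∈S = _ , _ , g∈S , gx , ε
    ... | inj₂ (g∈K , s , z , s∈S , sz , z⋆src) =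
      s , z , s∈S , sz , z⋆src ◅◅ edge-Reach H g∈K (src-Endpoint H _) gx

    Reach-lift : Incident H K S u → Reach H (S ∪ K) u v → Reach H (lift S) u v
    Reach-lift u∼S ε = ε
    Reach-lift {S = S} u∼S ((g , g∈S∪K , gu , gw) ◅ w⋆v) =
      (g , g∈lift , gu , gw) ◅ Reach-lift (Incident-Reach H u∼S (edge-Reach H g∈S∪K gu gw)) w⋆v
      where
      g∈lift : g ∈ lift S
      g∈lift with x∈p∪q⁻ S K g∈S∪K
      ... | inj₁ g∈S = ∈lift⁺ g∈S
      ... | inj₂ g∈K =
        ∈lift-Attached⁺ (g∈K , Incident-Reach H u∼S (edge-Reach H g∈S∪K gu (src-Endpoint H g)))

    lift⁅k⁆⁻ : k ∈ K → g ∈ lift ⁅ k ⁆ → Attached ⁅ k ⁆ g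
    lift⁅k⁆⁻ {k} k∈K g∈ with ∈lift⁻ g∈
    ... | inj₁ g∈⁅k⁆ rewrite x∈⁅y⁆⇒x≡y k g∈⁅k⁆ = k∈K , k , _ , x∈⁅x⁆ k , src-Endpoint H k , ε
    ... | inj₂ g-attached = g-attached

    lift⁅k⁆⊆lift : k ∈ K → Incident H K ⁅ k ⁆ x → Incident H K S x → lift ⁅ k ⁆ ⊆ lift S
    lift⁅k⁆⊆lift {k = k} {x = x} k∈K (_ , z , k′∈⁅k⁆ , k′z , z⋆x) (s , w , s∈S , sw , w⋆x) g∈
      with lift⁅k⁆⁻ k∈K g∈
    ... | g∈K , src∼k = ∈lift-Attached⁺ (g∈K , s , w , s∈S , sw , w⋆x ◅◅ through-k src∼k)
      where
      through-k : ∀ {u} → Incident H K ⁅ k ⁆ u → Reach H K x u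
      through-k (_ , z′ , k″∈⁅k⁆ , k″z′ , z′⋆u)
        rewrite x∈⁅y⁆⇒x≡y k k′∈⁅k⁆ | x∈⁅y⁆⇒x≡y k k″∈⁅k⁆ =
        Reach-sym H z⋆x ◅◅ edge-Reach H k∈K k′z k″z′ ◅◅ z′⋆u

    Seed : Pred (Subset m) 0ℓ
    Seed S = (∃[ k ] (k ∈ K × S ≡ ⁅ k ⁆)) ⊎ B S ≡ true

    Seed? : Decidable Seed
    Seed? S = any? (λ k → k ∈? K ×-dec S ≟ˢ ⁅ k ⁆) ⊎-dec B S ≟ᵇ true

    Seed-nonempty : Seed S → Nonempty S
    Seed-nonempty (inj₁ (k , _ , refl)) = k , x∈⁅x⁆ k
    Seed-nonempty (inj₂ S∈B) = proj₁ (proj₂ (bracket S∈B))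

    Seed-connected : Seed S → e ∈ S → f ∈ S → Endpoint H e x → Endpoint H f y → Reach H (S ∪ K) x y
    Seed-connected (inj₁ (k , _ , refl)) e∈⁅k⁆ f∈⁅k⁆ ex fy
      rewrite x∈⁅y⁆⇒x≡y k e∈⁅k⁆ | x∈⁅y⁆⇒x≡y k f∈⁅k⁆ = edge-Reach H (p⊆p∪q K (x∈⁅x⁆ k)) ex fy
    Seed-connected (inj₂ S∈B) e∈S f∈S ex fy = proj₂ (proj₂ (bracket S∈B)) _ _ _ _ e∈S f∈S ex fy

    lift-connected : Seed S → e ∈ lift S → f ∈ lift S → Endpoint H e x → Endpoint H f y → Reach H (lift S) x y
    lift-connected {S} seed e∈ f∈ ex fy with lift-Endpoint e∈ ex | lift-Endpoint f∈ fy
    ... | b , x₀ , b∈S , bx₀ , x₀⋆x | c , y₀ , c∈S , cy₀ , y₀⋆y =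
      Reach-sym H (from-x₀ (Reach-mono H (q⊆p∪q S K) x₀⋆x)) ◅◅
      from-x₀ (Seed-connected seed b∈S c∈S bx₀ cy₀ ◅◅ Reach-mono H (q⊆p∪q S K) y₀⋆y)
      where
      from-x₀ : ∀ {v} → Reach H (S ∪ K) x₀ v → Reach H (lift S) x₀ v
      from-x₀ = Reach-lift (b , x₀ , b∈S , bx₀ , ε)

    lifts-nested : Seed S → Seed S′ → Incident H K S x → Incident H K S′ x →
                   lift S ⊆ lift S′ ⊎ lift S′ ⊆ lift S
    lifts-nested (inj₁ (k , k∈K , refl)) _ x∼k x∼S′ = inj₁ (lift⁅k⁆⊆lift k∈K x∼k x∼S′)
    lifts-nested (inj₂ _) (inj₁ (k , k∈K , refl)) x∼S x∼k = inj₂ (lift⁅k⁆⊆lift k∈K x∼k x∼S)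
    lifts-nested (inj₂ S∈B) (inj₂ S′∈B) (b , x₀ , b∈S , bx₀ , x₀⋆x) (c , y₀ , c∈S′ , cy₀ , y₀⋆x) =
      Sum.map lift-mono lift-mono
        (ShareVertex⇒nested S∈B S′∈B
          (b , c , x₀ , y₀ , b∈S , c∈S′ , bx₀ , cy₀ , x₀⋆x ◅◅ Reach-sym H y₀⋆x))

    -- The bracketing of H attached to P: H itself, the components of K (lifts of single edges
    -- of K) and the preimages of the brackets of P.
    FanBracket : Pred (Subset m) 0ℓ
    FanBracket T = (T ≡ ∁ ⊥ × Nonempty T) ⊎ (∃[ S ] (Seed S × T ≡ lift S))

    FanBracket? : Decidable FanBracket
    FanBracket? T = (T ≟ˢ ∁ ⊥ ×-dec nonempty? T) ⊎-dec anySubset? (λ S → Seed? S ×-dec T ≟ˢ lift S)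

    private
      ⊆∁⊥ : T ⊆ ∁ ⊥
      ⊆∁⊥ _ = x∉p⇒x∈∁p ∉⊥

    fan-bracket : Connected H → FanBracket T → IsBracket H ⊥ T
    fan-bracket connected (inj₁ (refl , nonempty)) =
      (λ _ _ → ∉⊥) , nonempty ,
      λ _ _ x y _ _ _ _ → Reach-mono H (λ _ → p⊆p∪q ⊥ (⊆∁⊥ ∈⊤)) (connected x y)
    fan-bracket _ (inj₂ (S , seed , refl)) =
      (λ _ _ → ∉⊥) , (let s , s∈S = Seed-nonempty seed in s , ∈lift⁺ s∈S) ,
      λ _ _ _ _ e∈ f∈ ex fy → Reach-mono H (p⊆p∪q ⊥) (lift-connected seed e∈ f∈ ex fy)

    fan-nested : FanBracket T → FanBracket T′ → e ∈ T → f ∈ T′ → Endpoint H e x → Endpoint H f y →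
                 Reach H K x y → T ⊆ T′ ⊎ T′ ⊆ T
    fan-nested (inj₁ (refl , _)) _ _ _ _ _ _ = inj₂ ⊆∁⊥
    fan-nested (inj₂ _) (inj₁ (refl , _)) _ _ _ _ _ = inj₁ ⊆∁⊥
    fan-nested (inj₂ (S , S-seed , refl)) (inj₂ (S′ , S′-seed , refl)) e∈ f∈ ex fy x⋆y =
      lifts-nested S-seed S′-seed (lift-Endpoint e∈ ex)
        (Incident-Reach H (lift-Endpoint f∈ fy) (Reach-mono H (q⊆p∪q S′ K) (Reach-sym H x⋆y)))

    fan-compatible : FanBracket T → FanBracket T′ → Compatible H ⊥ T T′
    fan-compatible {T} {T′} T-fan T′-fan with T ⊆? T′ | T′ ⊆? T
    ... | yes T⊆T′ | _ = inj₁ (inj₁ T⊆T′)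
    ... | no _ | yes T′⊆T = inj₁ (inj₂ T′⊆T)
    ... | no T⊈T′ | no T′⊈T = inj₂ (no-edge , no-vertex)
      where
      no-vertex : ¬ ShareVertex H ⊥ T T′
      no-vertex (_ , _ , _ , _ , e∈T , f∈T′ , ex , fy , x⋆y) =
        [ T⊈T′ , T′⊈T ]′
          (fan-nested T-fan T′-fan e∈T f∈T′ ex fy (Reach-mono H (λ x∈⊥ → contradiction x∈⊥ ∉⊥) x⋆y))
      no-edge : ¬ ShareEdge H T T′
      no-edge (e , e∈T , e∈T′) =
        no-vertex (e , e , _ , _ , e∈T , e∈T′ , src-Endpoint H e , src-Endpoint H e , ε)

    module _ (connected : Connected H) where

      fanBracketing : Bracketing H
      fanBracketing = does ∘ FanBracket? ,
        IsBracketing-does H ⊥ FanBracket? (fan-bracket connected) fan-compatible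
          (λ (e , _) → inj₁ (refl , e , ⊆∁⊥ ∈⊤))

      private
        Bᶠ = proj₁ fanBracketing
        module fan = PreBracketingProperties H (preBr ⊥ Bᶠ (proj₂ fanBracketing))

        lift∈Bᶠ : Seed S → Bᶠ (lift S) ≡ true
        lift∈Bᶠ seed = dec-true (FanBracket? _) (inj₂ (_ , seed , refl))

      brᶠ-K : k ∈ K → IsBr H Bᶠ k (lift ⁅ k ⁆)
      brᶠ-K {k} k∈K = lift∈Bᶠ (inj₁ (k , k∈K , refl)) , ∈lift⁺ (x∈⁅x⁆ k) , least
        where
        least : ∀ T → Bᶠ T ≡ true → k ∈ T → lift ⁅ k ⁆ ⊆ T
        least T T∈Bᶠ k∈T with does-true⇒ (FanBracket? T) T∈Bᶠ
        ... | inj₁ (refl , _) = ⊆∁⊥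
        ... | inj₂ (S , _ , refl) =
          lift⁅k⁆⊆lift k∈K (k , _ , x∈⁅x⁆ k , src-Endpoint H k , ε) (lift-Endpoint k∈T (src-Endpoint H k))

      brᶠ-∉K : (e∉K : e ∉ K) → IsBr H Bᶠ e (lift (br e∉K))
      brᶠ-∉K {e} e∉K = lift∈Bᶠ (inj₂ (br∈B e∉K)) , ∈lift⁺ (∈br e∉K) , least
        where
        least : ∀ T → Bᶠ T ≡ true → e ∈ T → lift (br e∉K) ⊆ T
        least T T∈Bᶠ e∈T with does-true⇒ (FanBracket? T) T∈Bᶠ
        ... | inj₁ (refl , _) = ⊆∁⊥
        ... | inj₂ (S , inj₁ (k , k∈K , refl) , refl) =
          contradiction (subst (_∈ K) (sym (x∈⁅y⁆⇒x≡y k (lift-∉K e∈T e∉K))) k∈K) e∉K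
        ... | inj₂ (S , inj₂ S∈B , refl) = lift-mono (br-least e∉K S∈B (lift-∉K e∈T e∉K))

      posCone≐fanCone : posCone H P U.≐ fanCone H fanBracketing K
      posCone≐fanCone = P⊆fan , fan⊆P
        where
        P⊆fan : posCone H P U.⊆ fanCone H fanBracketing K
        P⊆fan {y} y∈P@(vanish , _ , monotone) = monotone′ , posCone⇒≥0 H P y∈P , vanish
          where
          monotone′ : cone H Bᶠ y
          monotone′ e f e≥f with f ∈? K | e ∈? K
          ... | yes f∈K | _ = subst (_≤ y e) (sym (vanish f f∈K)) (posCone⇒≥0 H P y∈P e)
          ... | no f∉K | yes e∈K =
            contradiction (proj₁ (lift⁅k⁆⁻ e∈K (fan.GeB⇒∈br e≥f (brᶠ-K e∈K)))) f∉K
          ... | no f∉K | no e∉K =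
            monotone e f (∈br⇒GeB (br-IsBr e∉K) (lift-∉K (fan.GeB⇒∈br e≥f (brᶠ-∉K e∉K)) f∉K))
        fan⊆P : fanCone H fanBracketing K U.⊆ posCone H P
        fan⊆P (monotone , nonneg , vanish) =
          vanish , (λ e _ → nonneg e) ,
          λ e f e≥f → let e∉K = GeB⇒∉K e≥f in
            monotone e f (fan.∈br⇒GeB (brᶠ-∉K e∉K) (∈lift⁺ (GeB⇒∈br e≥f (br-IsBr e∉K))))


open PreBracketingCones
open import Data.Nat using (ℕ)
open import Data.Product using (_×_; ∃-syntax; _,_)
open import Function using (_⇔_; mk⇔)
open import Relation.Unary using (_⊆_; _≐_)
open import Relation.Unary.Properties using (≐-sym; ≐-trans)

proposition3p2 : ∀ {n m : ℕ} (H : Graph n m) → Connected H →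
    (∀ (P : PreBracketing H) → IsFanCone H (posCone H P)) ×
    (∀ C → IsFanCone H C → ∃[ P ] (posCone H P ≐ C)) ×
    (∀ (P Q : PreBracketing H) → posCone H P ≐ posCone H Q → _≈P_ H P Q) ×
    (∀ (P Q : PreBracketing H) → _≤P_ H P Q ⇔ (posCone H P ⊆ posCone H Q))
proposition3p2 H connected =
  (λ P → fanBracketing H P connected , PreBracketing.K P , posCone≐fanCone H P connected) ,
  (λ C (Bk , F , C≐fan) → let P , P≐fan = fanCone⇒posCone H Bk F in P , ≐-trans P≐fan (≐-sym C≐fan)) ,
  posCone-injective H ,
  λ P Q → mk⇔ (≤P⇒posCone-⊆ H P Q) (posCone-⊆⇒≤P H P Q)
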